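{- For every integer $k\geq 1$ there is a graph that converges in exactly $k$ steps under the operator $KB_e$.
   Context: All graphs are finite, simple and undirected. A biclique of a graph $G$ is a maximal induced complete bipartite subgraph of $G$. The edge-biclique graph $KB_e(G)$ has one vertex for each biclique of $G$, two vertices being adjacent when the corresponding bicliques share at least one edge. Iterates: $KB_e^0(G)=G$, $KB_e^k(G)=KB_e(KB_e^{k-1}(G))$. A graph $G$ converges in $k$ steps if $k$ is the least integer such that $KB_e^j(G)\cong KB_e^k(G)$ for all $j\geq k$. -}

module Defs where

open import Data.Nat using (ℕ; _≤_; _<_)
open import Data.Fin using (Fin)
open import Data.Fin.Subset using (Subset; _∈_; _⊆_; _∪_; Nonempty)
open import Data.Product using (Σ; ∃; ∃-syntax; _×_)
open import Data.Empty using (⊥)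
open import Relation.Nullary using (¬_)
open import Relation.Binary.PropositionalEquality using (_≡_; _≢_)
open import Function.Bundles using (_↔_; _⇔_; Inverse)

record Graph : Set₁ where
  field
    n     : ℕ
    adj   : Fin n → Fin n → Set
    sym   : ∀ {u v} → adj u v → adj v u
    irrefl : ∀ {u} → ¬ adj u u
open Graph public

_≅_ : Graph → Graph → Set
G ≅ H = Σ (Fin (n G) ↔ Fin (n H)) λ f →
          ∀ u v → adj G u v ⇔ adj H (Inverse.to f u) (Inverse.to f v)

InducesCompleteBipartite : (G : Graph) → Subset (n G) → Set
InducesCompleteBipartite G S =
  ∃[ X ] ∃[ Y ]
    ( Nonempty X × Nonempty Y
    × (∀ v → v ∈ X → v ∈ Y → ⊥)
    × (X ∪ Y ≡ S)
    × (∀ u v → u ∈ X → v ∈ X → ¬ adj G u v)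
    × (∀ u v → u ∈ Y → v ∈ Y → ¬ adj G u v)
    × (∀ u v → u ∈ X → v ∈ Y → adj G u v))

IsBiclique : (G : Graph) → Subset (n G) → Set
IsBiclique G S =
  InducesCompleteBipartite G S
  × (∀ T → S ⊆ T → InducesCompleteBipartite G T → T ≡ S)

-- Two vertex sets share an edge of G (as the bicliques are induced
-- subgraphs, an edge of G with both ends in both sets is an edge of both).
ShareEdge : (G : Graph) → Subset (n G) → Subset (n G) → Set
ShareEdge G S T =
  ∃[ u ] ∃[ v ] (u ∈ S × v ∈ S × u ∈ T × v ∈ T × adj G u v)

-- H is (a copy of) the edge-biclique graph KB_e(G): its vertices are
-- labelled injectively by b with exactly the bicliques of G, and two
-- distinct vertices are adjacent iff their bicliques share an edge.
IsKBe : Graph → Graph → Set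
IsKBe G H =
  Σ (Fin (n H) → Subset (n G)) λ b →
      (∀ i j → b i ≡ b j → i ≡ j)
    × (∀ i → IsBiclique G (b i))
    × (∀ S → IsBiclique G S → ∃[ i ] (b i ≡ S))
    × (∀ i j → adj H i j ⇔ (i ≢ j × ShareEdge G (b i) (b j)))

-- seq is the sequence of iterates KB_e^i(G) (each up to isomorphism).
IsIterSeq : Graph → (ℕ → Graph) → Set₁
IsIterSeq G seq = (seq 0 ≡ G) × (∀ i → IsKBe (seq i) (seq (Data.Nat.suc i)))

StableFrom : (ℕ → Graph) → ℕ → Set
StableFrom seq k = ∀ j → k ≤ j → seq j ≅ seq k

ConvergesIn : Graph → ℕ → Set₁
ConvergesIn G k =
  ∃[ seq ] (IsIterSeq G seq × StableFrom seq k
            × (∀ k′ → k′ < k → ¬ StableFrom seq k′))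

-- A path has no 4-cycle, so every induced complete bipartite subgraph
-- is a star inside a closed neighbourhood, and the bicliques of P_{m+3} are
-- exactly its m+1 induced copies {i, i+1, i+2} of P₃; two of them share an edge
-- iff they are consecutive.  Hence KB_e(P_{m+3}) ≅ P_{m+1}, while P₁ and P₀ have
-- no bicliques and map to the empty graph P₀, a fixed point.  So P_{2k−1} loses
-- two vertices per step and becomes empty after exactly k steps.
module Submission where

open import Defs hiding (sym)
open import Data.Nat using (ℕ; _≥_; zero; suc; _+_; _∸_; _≤_; _<_; z≤n; s≤s; s≤s⁻¹; pred)
open import Data.Nat.Properties
  using (≤-refl; ≤-trans; ≤-antisym; n≤1+n; m≤n⇒m≤1+n; ≰⇒>; _≤?_; +-suc; +-monoʳ-≤; 1+n≰n; <⇒≤;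
         pred[m∸n]≡m∸[1+n]; m≤n⇒m∸n≡0; n∸n≡0; m<n⇒0<n∸m)
open import Data.Fin using (Fin; toℕ; fromℕ<; inject₁; _≟_) renaming (zero to fzero; suc to fsuc)
open import Data.Fin.Properties using (toℕ-injective; toℕ<n; toℕ-fromℕ<; toℕ-inject₁; any?)
open import Data.Fin.Subset using (Subset; _∈_; _⊆_; _∪_; ⁅_⁆)
open import Data.Fin.Subset.Properties using (⊆-antisym; x∈p∪q⁻; x∈p∪q⁺; x∈⁅x⁆; x∈⁅y⁆⇒x≡y; _∈?_)
open import Data.Product using (∃-syntax; _×_; _,_; proj₁)
open import Data.Sum using (_⊎_; inj₁; inj₂; map₁)
open import Data.Empty using (⊥; ⊥-elim)
open import Relation.Nullary using (¬_; yes; no; _×-dec_; ¬?)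
open import Relation.Binary.PropositionalEquality
  using (_≡_; _≢_; refl; sym; trans; cong; subst; subst₂)
open import Function using (id)
open import Function.Bundles using (_⇔_; Inverse; mk⇔)
open import Function.Properties.Inverse using (↔-refl)

≅-reflexive : ∀ {G H} → G ≡ H → G ≅ H
≅-reflexive refl = ↔-refl , λ _ _ → mk⇔ id id

ClosedNeighbourhood : (G : Graph) → Fin (n G) → Subset (n G) → Set
ClosedNeighbourhood G c S = ∀ v → v ∈ S → v ≡ c ⊎ adj G c v

CommonNeighbourUnique : Graph → Set
CommonNeighbourUnique G =
  ∀ {x x′ a b} → x ≢ x′ → adj G x a → adj G x′ a → adj G x b → adj G x′ b → a ≡ b

completeBipartite⊆closedNeighbourhood :
  ∀ G → CommonNeighbourUnique G →
  ∀ S → InducesCompleteBipartite G S → ∃[ c ] ClosedNeighbourhood G c S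
completeBipartite⊆closedNeighbourhood G unique S
  (X , Y , (x , x∈X) , (y , y∈Y) , _ , X∪Y≡S , _ , _ , complete)
  with any? (λ x′ → (x′ ∈? X) ×-dec ¬? (x′ ≟ x))
... | no x-alone = x , λ v v∈S → star (x∈p∪q⁻ X Y (subst (v ∈_) (sym X∪Y≡S) v∈S))
  where
  star : ∀ {v} → v ∈ X ⊎ v ∈ Y → v ≡ x ⊎ adj G x v
  star {v} (inj₁ v∈X) with v ≟ x
  ... | yes v≡x = inj₁ v≡x
  ... | no v≢x = ⊥-elim (x-alone (v , v∈X , v≢x))
  star (inj₂ v∈Y) = inj₂ (complete _ _ x∈X v∈Y)
... | yes (x′ , x′∈X , x′≢x) = y , λ v v∈S → star (x∈p∪q⁻ X Y (subst (v ∈_) (sym X∪Y≡S) v∈S))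
  where
  star : ∀ {v} → v ∈ X ⊎ v ∈ Y → v ≡ y ⊎ adj G y v
  star (inj₁ v∈X) = inj₂ (Graph.sym G (complete _ _ v∈X y∈Y))
  -- v and y are both common neighbours of x ≠ x′, hence equal.
  star (inj₂ v∈Y) = inj₁ (unique (λ x≡x′ → x′≢x (sym x≡x′))
    (complete _ _ x∈X v∈Y) (complete _ _ x′∈X v∈Y) (complete _ _ x∈X y∈Y) (complete _ _ x′∈X y∈Y))

chain-convergesIn :
  (R : ℕ → Graph) → IsKBe (R 0) (R 0) → (∀ m → IsKBe (R (suc m)) (R m)) →
  (∀ m → ¬ R 0 ≅ R (suc m)) → ∀ k → ConvergesIn (R k) k
chain-convergesIn R fixed step distinct k = seq , (refl , iterate) , stable , minimal
  where
  seq : ℕ → Graph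
  seq i = R (k ∸ i)

  step-pred : ∀ m → IsKBe (R m) (R (pred m))
  step-pred zero = fixed
  step-pred (suc m) = step m

  iterate : ∀ i → IsKBe (seq i) (seq (suc i))
  iterate i = subst (λ x → IsKBe (R (k ∸ i)) (R x)) (pred[m∸n]≡m∸[1+n] k i) (step-pred (k ∸ i))

  stable : StableFrom seq k
  stable j k≤j = ≅-reflexive (cong R (trans (m≤n⇒m∸n≡0 k≤j) (sym (n∸n≡0 k))))

  R0≇ : ∀ d → 0 < d → ¬ R 0 ≅ R d
  R0≇ (suc d) _ = distinct d

  minimal : ∀ k′ → k′ < k → ¬ StableFrom seq k′
  minimal k′ k′<k st =
    R0≇ (k ∸ k′) (m<n⇒0<n∸m k′<k) (subst (λ x → R x ≅ R (k ∸ k′)) (n∸n≡0 k) (st k (<⇒≤ k′<k)))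

data Consecutive : ℕ → ℕ → Set where
  up   : ∀ {a} → Consecutive a (suc a)
  down : ∀ {a} → Consecutive (suc a) a

Consecutive-sym : ∀ {a b} → Consecutive a b → Consecutive b a
Consecutive-sym up = down
Consecutive-sym down = up

Consecutive-irrefl : ∀ {a} → ¬ Consecutive a a
Consecutive-irrefl ()

Path : ℕ → Graph
Path N = record
  { n = N ; adj = λ u v → Consecutive (toℕ u) (toℕ v)
  ; sym = Consecutive-sym ; irrefl = Consecutive-irrefl }

path-commonNeighbourUnique : ∀ N → CommonNeighbourUnique (Path N)
path-commonNeighbourUnique N x≢x′ xa x′a xb x′b =
  toℕ-injective (unique (λ x≡x′ → x≢x′ (toℕ-injective x≡x′)) xa x′a xb x′b)
  where
  unique : ∀ {x x′ a b} → x ≢ x′ →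
           Consecutive x a → Consecutive x′ a → Consecutive x b → Consecutive x′ b → a ≡ b
  unique x≢x′ up   up   _    _    = ⊥-elim (x≢x′ refl)
  unique x≢x′ down down _    _    = ⊥-elim (x≢x′ refl)
  unique x≢x′ up   down up   down = refl
  unique x≢x′ down up   down up   = refl

isKBe-biclique-free : ∀ G → (∀ S → ¬ InducesCompleteBipartite G S) → IsKBe G (Path 0)
isKBe-biclique-free G free =
  (λ ()) , (λ ()) , (λ ()) , (λ S biclique → ⊥-elim (free S (proj₁ biclique))) , (λ ())

path0-biclique-free : ∀ S → ¬ InducesCompleteBipartite (Path 0) S
path0-biclique-free S (X , Y , (() , _) , _)

path1-biclique-free : ∀ S → ¬ InducesCompleteBipartite (Path 1) S
path1-biclique-free S (X , Y , (fzero , x∈X) , (fzero , y∈Y) , _ , _ , _ , _ , complete) =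
  Consecutive-irrefl (complete _ _ x∈X y∈Y)

path0≇path[1+n] : ∀ {N} → ¬ Path 0 ≅ Path (suc N)
path0≇path[1+n] (f , _) with Inverse.from f fzero
... | ()

data Window (c : ℕ) : ℕ → Set where
  left   : Window c c
  centre : Window c (suc c)
  right  : Window c (suc (suc c))

Window-bound : ∀ {c w} → Window c w → w ≤ 2 + c
Window-bound left = m≤n⇒m≤1+n (n≤1+n _)
Window-bound centre = n≤1+n _
Window-bound right = ≤-refl

Window-ends : ∀ {c a} → Window c a → Window c (2 + a) → c ≡ a
Window-ends left right = refl

IsEnd : ℕ → ℕ → Set
IsEnd c x = x ≡ c ⊎ x ≡ 2 + c

IsEnd⇒Window : ∀ {c x} → IsEnd c x → Window c x
IsEnd⇒Window (inj₁ refl) = left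
IsEnd⇒Window (inj₂ refl) = right

centre-not-end : ∀ {c} → ¬ IsEnd c (suc c)
centre-not-end (inj₁ ())
centre-not-end (inj₂ ())

ends-nonConsecutive : ∀ {c x y} → IsEnd c x → IsEnd c y → ¬ Consecutive x y
ends-nonConsecutive (inj₁ refl) (inj₁ refl) ()
ends-nonConsecutive (inj₁ refl) (inj₂ refl) ()
ends-nonConsecutive (inj₂ refl) (inj₁ refl) ()
ends-nonConsecutive (inj₂ refl) (inj₂ refl) ()

centre-consecutive-end : ∀ {c y} → IsEnd c y → Consecutive (suc c) y
centre-consecutive-end (inj₁ refl) = down
centre-consecutive-end (inj₂ refl) = up

closedNeighbourhood⊆Window :
  ∀ m c → c ≤ 2 + m →
  ∃[ j ] (j ≤ m × ∀ v → v ≤ 2 + m → v ≡ c ⊎ Consecutive c v → Window j v)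
closedNeighbourhood⊆Window m zero _ = zero , z≤n , λ where
  _ _ (inj₁ refl) → left
  _ _ (inj₂ up)   → centre
closedNeighbourhood⊆Window m (suc c) c≤1+m with c ≤? m
... | yes c≤m = c , c≤m , λ where
  _ _ (inj₁ refl) → centre
  _ _ (inj₂ up)   → right
  _ _ (inj₂ down) → left
... | no c≰m rewrite ≤-antisym (s≤s⁻¹ c≤1+m) (≰⇒> c≰m) = m , ≤-refl , λ where
  _ _   (inj₁ refl) → right
  _ _   (inj₂ down) → centre
  _ 3+m≤2+m (inj₂ up) → ⊥-elim (1+n≰n (s≤s⁻¹ (s≤s⁻¹ 3+m≤2+m)))

consecutiveWindows-shareEdge :
  ∀ {a b} → Consecutive a b →
  ∃[ u ] ∃[ v ] (Window a u × Window a v × Window b u × Window b v × Consecutive u v)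
consecutiveWindows-shareEdge up   = _ , _ , centre , right , left , centre , up
consecutiveWindows-shareEdge down = _ , _ , left , centre , centre , right , up

windowsShareEdge⇒consecutive :
  ∀ {a b u v} → a ≢ b → Window a u → Window a v → Window b u → Window b v →
  Consecutive u v → Consecutive a b
windowsShareEdge⇒consecutive a≢b left   centre centre right  up   = down
windowsShareEdge⇒consecutive a≢b centre right  left   centre up   = up
windowsShareEdge⇒consecutive a≢b centre left   right  centre down = down
windowsShareEdge⇒consecutive a≢b right  centre centre left   down = up
windowsShareEdge⇒consecutive a≢b left   centre left   centre up   = ⊥-elim (a≢b refl)
windowsShareEdge⇒consecutive a≢b centre right  centre right  up   = ⊥-elim (a≢b refl)
windowsShareEdge⇒consecutive a≢b centre left   centre left   down = ⊥-elim (a≢b refl)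
windowsShareEdge⇒consecutive a≢b right  centre right  centre down = ⊥-elim (a≢b refl)

module PathBicliques (m : ℕ) where

  left-end centre-of right-end : Fin (suc m) → Fin (3 + m)
  left-end i = inject₁ (inject₁ i)
  centre-of i = fsuc (inject₁ i)
  right-end i = fsuc (fsuc i)

  toℕ-left-end : ∀ i → toℕ (left-end i) ≡ toℕ i
  toℕ-left-end i = trans (toℕ-inject₁ (inject₁ i)) (toℕ-inject₁ i)

  toℕ-centre-of : ∀ i → toℕ (centre-of i) ≡ suc (toℕ i)
  toℕ-centre-of i = cong suc (toℕ-inject₁ i)

  ends : Fin (suc m) → Subset (3 + m)
  ends i = ⁅ left-end i ⁆ ∪ ⁅ right-end i ⁆

  window : Fin (suc m) → Subset (3 + m)
  window i = ⁅ centre-of i ⁆ ∪ ends i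

  ∈centre : ∀ {i v} → v ∈ ⁅ centre-of i ⁆ → toℕ v ≡ suc (toℕ i)
  ∈centre {i} p = trans (cong toℕ (x∈⁅y⁆⇒x≡y _ p)) (toℕ-centre-of i)

  ∈ends⇒IsEnd : ∀ {i v} → v ∈ ends i → IsEnd (toℕ i) (toℕ v)
  ∈ends⇒IsEnd {i} p with x∈p∪q⁻ ⁅ left-end i ⁆ ⁅ right-end i ⁆ p
  ... | inj₁ q = inj₁ (trans (cong toℕ (x∈⁅y⁆⇒x≡y _ q)) (toℕ-left-end i))
  ... | inj₂ q = inj₂ (cong toℕ (x∈⁅y⁆⇒x≡y _ q))

  left-end∈ends : ∀ i → left-end i ∈ ends i
  left-end∈ends i = x∈p∪q⁺ (inj₁ (x∈⁅x⁆ _))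

  ∈window⇒Window : ∀ {i v} → v ∈ window i → Window (toℕ i) (toℕ v)
  ∈window⇒Window {i} p with x∈p∪q⁻ ⁅ centre-of i ⁆ (ends i) p
  ... | inj₁ q = subst (Window _) (sym (∈centre q)) centre
  ... | inj₂ q = IsEnd⇒Window (∈ends⇒IsEnd q)

  Window⇒∈window : ∀ {i v} → Window (toℕ i) (toℕ v) → v ∈ window i
  Window⇒∈window {i} {v} w = go w refl
    where
    ∈⁅_⁆ : ∀ a → v ≡ a → v ∈ ⁅ a ⁆
    ∈⁅ a ⁆ refl = x∈⁅x⁆ a
    go : ∀ {x} → Window (toℕ i) x → toℕ v ≡ x → v ∈ window i
    go left   e = x∈p∪q⁺ (inj₂ (x∈p∪q⁺ (inj₁ (∈⁅ _ ⁆ (toℕ-injective (trans e (sym (toℕ-left-end i))))))))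
    go centre e = x∈p∪q⁺ (inj₁ (∈⁅ _ ⁆ (toℕ-injective (trans e (sym (toℕ-centre-of i))))))
    go right  e = x∈p∪q⁺ (inj₂ (x∈p∪q⁺ {p = ⁅ left-end i ⁆} (inj₂ (∈⁅ _ ⁆ (toℕ-injective e)))))

  window-⊆⇒≡ : ∀ {i j} → window i ⊆ window j → i ≡ j
  window-⊆⇒≡ {i} {j} i⊆j = toℕ-injective (sym (Window-ends
    (subst (Window (toℕ j)) (toℕ-left-end i) (∈window⇒Window (i⊆j (x∈p∪q⁺ (inj₂ (left-end∈ends i))))))
    (∈window⇒Window (i⊆j (x∈p∪q⁺ (inj₂ (x∈p∪q⁺ {p = ⁅ left-end i ⁆} (inj₂ (x∈⁅x⁆ _)))))))))

  window-completeBipartite : ∀ i → InducesCompleteBipartite (Path (3 + m)) (window i)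
  window-completeBipartite i =
    ⁅ centre-of i ⁆ , ends i , (centre-of i , x∈⁅x⁆ _) , (left-end i , left-end∈ends i) ,
    disjoint , refl , independent-centre , independent-ends , complete
    where
    disjoint : ∀ v → v ∈ ⁅ centre-of i ⁆ → v ∈ ends i → ⊥
    disjoint v p q = centre-not-end (subst (IsEnd _) (∈centre p) (∈ends⇒IsEnd q))
    independent-centre : ∀ u v → u ∈ ⁅ centre-of i ⁆ → v ∈ ⁅ centre-of i ⁆ → ¬ Consecutive (toℕ u) (toℕ v)
    independent-centre u v p q rewrite ∈centre p | ∈centre q = Consecutive-irrefl
    independent-ends : ∀ u v → u ∈ ends i → v ∈ ends i → ¬ Consecutive (toℕ u) (toℕ v)
    independent-ends u v p q = ends-nonConsecutive (∈ends⇒IsEnd p) (∈ends⇒IsEnd q)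
    complete : ∀ u v → u ∈ ⁅ centre-of i ⁆ → v ∈ ends i → Consecutive (toℕ u) (toℕ v)
    complete u v p q =
      subst (λ x → Consecutive x (toℕ v)) (sym (∈centre p)) (centre-consecutive-end (∈ends⇒IsEnd q))

  completeBipartite⊆window :
    ∀ S → InducesCompleteBipartite (Path (3 + m)) S → ∃[ j ] S ⊆ window j
  completeBipartite⊆window S cb
    with completeBipartite⊆closedNeighbourhood (Path (3 + m)) (path-commonNeighbourUnique _) S cb
  ... | c , S⊆N[c] with closedNeighbourhood⊆Window m (toℕ c) (s≤s⁻¹ (toℕ<n c))
  ... | j , j≤m , N[c]⊆W[j] = fromℕ< (s≤s j≤m) , λ {v} v∈S →
    Window⇒∈window (subst (λ x → Window x (toℕ v)) (sym (toℕ-fromℕ< (s≤s j≤m)))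
      (N[c]⊆W[j] (toℕ v) (s≤s⁻¹ (toℕ<n v)) (map₁ (cong toℕ) (S⊆N[c] v v∈S))))

  window-isBiclique : ∀ i → IsBiclique (Path (3 + m)) (window i)
  window-isBiclique i = window-completeBipartite i , maximal
    where
    maximal : ∀ T → window i ⊆ T → InducesCompleteBipartite (Path (3 + m)) T → T ≡ window i
    maximal T i⊆T cbT with completeBipartite⊆window T cbT
    ... | j , T⊆j with window-⊆⇒≡ (λ p → T⊆j (i⊆T p))
    ... | refl = ⊆-antisym T⊆j i⊆T

  biclique⇒window : ∀ S → IsBiclique (Path (3 + m)) S → ∃[ j ] window j ≡ S
  biclique⇒window S (cbS , maximal) with completeBipartite⊆window S cbS
  ... | j , S⊆j = j , maximal (window j) S⊆j (window-completeBipartite j)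

  windows-shareEdge⇔consecutive :
    ∀ i j → Consecutive (toℕ i) (toℕ j) ⇔ (i ≢ j × ShareEdge (Path (3 + m)) (window i) (window j))
  windows-shareEdge⇔consecutive i j = mk⇔ to from
    where
    vertex : ∀ {x} → Window (toℕ i) x → Fin (3 + m)
    vertex w = fromℕ< (s≤s (≤-trans (Window-bound w) (+-monoʳ-≤ 2 (s≤s⁻¹ (toℕ<n i)))))
    toℕ-vertex : ∀ {x} (w : Window (toℕ i) x) → toℕ (vertex w) ≡ x
    toℕ-vertex w = toℕ-fromℕ< _
    vertex∈ : ∀ {k x} (w : Window (toℕ i) x) → Window (toℕ k) x → vertex w ∈ window k
    vertex∈ w w′ = Window⇒∈window (subst (Window _) (sym (toℕ-vertex w)) w′)
    to : Consecutive (toℕ i) (toℕ j) → i ≢ j × ShareEdge (Path (3 + m)) (window i) (window j)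
    to i~j with consecutiveWindows-shareEdge i~j
    ... | _ , _ , iu , iv , ju , jv , u~v =
      (λ { refl → Consecutive-irrefl i~j }) ,
      vertex iu , vertex iv , vertex∈ iu iu , vertex∈ iv iv , vertex∈ iu ju , vertex∈ iv jv ,
      subst₂ Consecutive (sym (toℕ-vertex iu)) (sym (toℕ-vertex iv)) u~v
    from : i ≢ j × ShareEdge (Path (3 + m)) (window i) (window j) → Consecutive (toℕ i) (toℕ j)
    from (i≢j , u , v , u∈i , v∈i , u∈j , v∈j , u~v) =
      windowsShareEdge⇒consecutive (λ e → i≢j (toℕ-injective e))
        (∈window⇒Window u∈i) (∈window⇒Window v∈i) (∈window⇒Window u∈j) (∈window⇒Window v∈j) u~v

  isKBe : IsKBe (Path (3 + m)) (Path (suc m))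
  isKBe =
    window , (λ i j i≡j → window-⊆⇒≡ (λ p → subst (_ ∈_) i≡j p)) , window-isBiclique ,
    biclique⇒window , windows-shareEdge⇔consecutive

oddPath : ℕ → Graph
oddPath zero = Path 0
oddPath (suc k) = Path (suc (k + k))

oddPath-isKBe : ∀ k → IsKBe (oddPath (suc k)) (oddPath k)
oddPath-isKBe zero = isKBe-biclique-free (Path 1) path1-biclique-free
oddPath-isKBe (suc k) rewrite +-suc k k = PathBicliques.isKBe (k + k)

corollary2 : ∀ (k : ℕ) → k ≥ 1 → ∃[ G ] ConvergesIn G k
corollary2 k _ =
  oddPath k ,
  chain-convergesIn oddPath (isKBe-biclique-free (Path 0) path0-biclique-free) oddPath-isKBe
    (λ _ → path0≇path[1+n]) k
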